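{- Let $n>1$ and $p>1$ be integers and let $G=H_{n,p}$. Then $\theta(G)=0$ if $n$ is even or if $n$ and $p$ are both odd, and $\theta(G)=1$ if $n$ is odd and $p$ is even.
   Context: $H_{n,p}$ denotes the complete multipartite graph with $p$ parts each having exactly $n$ vertices. For a finite set $S$ of positive integers with $|S|=|V(G)|$, a graph $G$ is $S$-magic if there is a bijection $f:V(G)\to S$ and a constant $c$ with $\sum_{v\in N(u)} f(v)=c$ for every vertex $u$, where $N(u)$ is the set of neighbours of $u$. Let $\alpha(S)=\max S$ and $i(G)=\min \alpha(S)$ over all $S$ for which $G$ is $S$-magic; the distance magic index is $\theta(G)=i(G)-|V(G)|$ (and $\theta(G)=\infty$ if no such $S$ exists). -}

module Defs where

open import Data.Nat using (ℕ; zero; suc; _+_; _*_; _≤_; _⊔_)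
open import Data.Fin using (Fin; quotient)
open import Data.Fin.Properties using (_≟_)
open import Data.List using (List; map; foldr; allFin)
open import Data.Nat.ListAction using (sum)
open import Data.Bool using (Bool; if_then_else_; not)
open import Data.Product using (Σ; ∃; _×_)
open import Relation.Binary.PropositionalEquality using (_≡_)
open import Relation.Nullary.Decidable using (⌊_⌋)
open import Function.Definitions using (Injective)

record Graph : Set where
  field
    order : ℕ
    adj   : Fin order → Fin order → Bool
open Graph public

-- H_{n,p}: vertices Fin (p * n) ≅ Fin p × Fin n (part, index in part);
-- two vertices are adjacent iff they lie in different parts.
H : ℕ → ℕ → Graph
H n p = record
  { order = p * n
  ; adj   = λ u v → not ⌊ quotient {p} n u ≟ quotient {p} n v ⌋
  }

nbrSum : (G : Graph) → (Fin (order G) → ℕ) → Fin (order G) → ℕ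
nbrSum G f u = sum (map (λ v → if adj G u v then f v else 0) (allFin (order G)))

maxLabel : (G : Graph) → (Fin (order G) → ℕ) → ℕ
maxLabel G f = foldr _⊔_ 0 (map f (allFin (order G)))

-- f is a bijection onto its image S, a set of positive integers with |S| = |V(G)|,
-- and G is S-magic via f (constant neighbourhood sums).
IsMagicLabelling : (G : Graph) → (Fin (order G) → ℕ) → Set
IsMagicLabelling G f =
  Injective _≡_ _≡_ f × (∀ v → 1 ≤ f v) × ∃ λ c → ∀ u → nbrSum G f u ≡ c

IndexIs : Graph → ℕ → Set
IndexIs G m =
  (∃ λ f → IsMagicLabelling G f × maxLabel G f ≡ m)
  × (∀ f → IsMagicLabelling G f → m ≤ maxLabel G f)

ThetaIs : Graph → ℕ → Set
ThetaIs G t = IndexIs G (order G + t)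

module Submission where

-- A vertex of H n p is adjacent to everything outside its own part, so its
-- neighbourhood sum is the total label sum minus the label sum of its part: a labelling is
-- magic exactly when all p parts carry the same label sum. As the labels are distinct
-- positive integers, the largest is at least pn, so θ = 0 amounts to writing 1, …, pn into a
-- p × n array with equal row sums. Pairs of columns (i, 2p − 1 − i) do this for even n; odd
-- n needs in addition three columns with equal row sums, which exist on the values 1, …, 3p
-- for odd p and on 1, …, 3p + 1 with one value omitted for even p. For odd n and even p
-- the labels cannot be exactly 1, …, pn, since the common part sum would be n(pn + 1)/2.

open import Defs
open import Data.Bool using (true; false; if_then_else_; not)
open import Data.Empty using (⊥-elim)
open import Data.Fin using (Fin; zero; suc; toℕ; fromℕ<; join; combine; quotient; remainder; splitAt; _↑ˡ_; _↑ʳ_; punchIn; opposite)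
open import Data.Fin.Properties using (_≟_; any?; toℕ<n; toℕ-injective; fromℕ<-injective; opposite-prop; opposite-involutive; remQuot-combine; combine-remQuot; join-splitAt; punchInᵢ≢i; punchIn-injective; injective⇒≤)
open import Data.List as List using (allFin; tabulate)
open import Data.List.Properties using (map-tabulate)
open import Data.Nat using (ℕ; zero; suc; pred; _+_; _*_; _∸_; _≤_; _<_; _⊔_; z≤n; s≤s; s≤s⁻¹; z<s; NonZero; >-nonZero)
open import Data.Nat.Divisibility using (_∣_; divides; _∣0; ∣-trans; m∣m*n; ∣m+n∣m⇒∣n; ∣1⇒≡1; m%n≡0⇒n∣m)
open import Data.Nat.DivMod using (_/_; _%_; m≡m%n+[m/n]*n; m%n<n)
open import Data.Nat.Primality using (euclidsLemma; prime[2])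
open import Data.Nat.Properties renaming (_≟_ to _≟ℕ_)
open import Data.Nat.Tactic.RingSolver using (solve-∀)
open import Algebra.Properties.CommutativeMonoid.Sum +-0-commutativeMonoid
  using (sum; sum-syntax; sum-cong-≗; sum-remove; sum-replicate-zero; ∑-distrib-+)
open import Data.Product using (∃; _×_; _,_; proj₁; proj₂)
open import Data.Sum using (_⊎_; inj₁; inj₂)
open import Data.Vec.Functional as Vector using (Vector; _++_)
open import Data.Vec.Functional.Properties using (lookup-++ˡ; lookup-++ʳ)
open import Function using (_∘_; id)
open import Function.Definitions using (Injective)
open import Relation.Binary.PropositionalEquality
open import Relation.Nullary using (¬_; yes; no)
open import Relation.Nullary.Decidable using (⌊_⌋)

open ≡-Reasoning

foldr-map-allFin : ∀ {A : Set} (_∙_ : A → A → A) e n (h : Fin n → A) →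
  List.foldr _∙_ e (List.map h (allFin n)) ≡ Vector.foldr _∙_ e h
foldr-map-allFin _∙_ e n h = trans (cong (List.foldr _∙_ e) (map-tabulate id h)) (foldr-tabulate n h)
  where
  foldr-tabulate : ∀ n (h : Fin n → _) → List.foldr _∙_ e (tabulate h) ≡ Vector.foldr _∙_ e h
  foldr-tabulate zero    h = refl
  foldr-tabulate (suc n) h = cong (h zero ∙_) (foldr-tabulate n (h ∘ suc))

∑-const : ∀ n c → ∑[ i < n ] c ≡ n * c
∑-const zero    c = refl
∑-const (suc n) c = cong (c +_) (∑-const n c)

∑-shift : ∀ {n} c (x : Vector ℕ n) → ∑[ j < n ] (c + x j) ≡ n * c + sum x
∑-shift {n} c x = trans (∑-distrib-+ (λ _ → c) x) (cong (_+ sum x) (∑-const n c))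

∑-↑ : ∀ m n (h : Vector ℕ (m + n)) → sum h ≡ ∑[ i < m ] h (i ↑ˡ n) + ∑[ j < n ] h (m ↑ʳ j)
∑-↑ zero    n h = refl
∑-↑ (suc m) n h = trans (cong (h zero +_) (∑-↑ m n (h ∘ suc))) (sym (+-assoc (h zero) _ _))

∑-++ : ∀ {m n} (xs : Vector ℕ m) (ys : Vector ℕ n) → sum (xs ++ ys) ≡ sum xs + sum ys
∑-++ {m} {n} xs ys = trans (∑-↑ m n (xs ++ ys))
  (cong₂ _+_ (sum-cong-≗ (lookup-++ˡ xs ys)) (sum-cong-≗ (lookup-++ʳ xs ys)))

∑-combine : ∀ m n (h : Vector ℕ (m * n)) → sum h ≡ ∑[ i < m ] ∑[ j < n ] h (combine i j)
∑-combine zero    n h = refl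
∑-combine (suc m) n h =
  trans (∑-↑ n (m * n) h) (cong (∑[ j < n ] h (j ↑ˡ m * n) +_) (∑-combine m n (h ∘ (n ↑ʳ_))))

∑-if : ∀ {n} b (x : Vector ℕ n) → ∑[ j < n ] (if b then x j else 0) ≡ (if b then sum x else 0)
∑-if true  x = refl
∑-if {n} false x = sum-replicate-zero n

∑-except : ∀ {p} (x : Vector ℕ p) a → ∑[ i < p ] (if not ⌊ a ≟ i ⌋ then x i else 0) + x a ≡ sum x
∑-except {suc p} x a = begin
  sum g + x a
    ≡⟨ cong (_+ x a) (sum-remove {i = a} g) ⟩
  g a + sum (g ∘ punchIn a) + x a
    ≡⟨ cong₂ (λ u v → u + v + x a) g-at-a (sum-cong-≗ g-elsewhere) ⟩
  sum (x ∘ punchIn a) + x a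
    ≡⟨ +-comm _ (x a) ⟩
  x a + sum (x ∘ punchIn a)
    ≡⟨ sum-remove x ⟨
  sum x ∎
  where
  g : Vector ℕ (suc p)
  g i = if not ⌊ a ≟ i ⌋ then x i else 0
  g-at-a : g a ≡ 0
  g-at-a with a ≟ a
  ... | yes _   = refl
  ... | no  a≢a = ⊥-elim (a≢a refl)
  g-elsewhere : ∀ i → g (punchIn a i) ≡ x (punchIn a i)
  g-elsewhere i with a ≟ punchIn a i
  ... | yes a≡ = ⊥-elim (punchInᵢ≢i a i (sym a≡))
  ... | no  _  = refl

maximum : ∀ {n} → Vector ℕ n → ℕ
maximum = Vector.foldr _⊔_ 0

≤-maximum : ∀ {n} (x : Vector ℕ n) i → x i ≤ maximum x
≤-maximum x zero    = m≤m⊔n _ _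
≤-maximum x (suc i) = ≤-trans (≤-maximum (x ∘ suc) i) (m≤n⊔m _ _)

maximum-≤ : ∀ {n} {x : Vector ℕ n} {M} → (∀ i → x i ≤ M) → maximum x ≤ M
maximum-≤ {zero}  x≤M = z≤n
maximum-≤ {suc n} x≤M = ⊔-lub (x≤M zero) (maximum-≤ (x≤M ∘ suc))

maxLabel≡maximum : ∀ G f → maxLabel G f ≡ maximum f
maxLabel≡maximum G f = foldr-map-allFin _⊔_ 0 (order G) f

-- Neighbourhood sums in H n p

partSum : ∀ n p → Vector ℕ (p * n) → Fin p → ℕ
partSum n p f i = ∑[ j < n ] f (combine i j)

quotient-combine : ∀ {p} n (i : Fin p) (j : Fin n) → quotient {p} n (combine i j) ≡ i
quotient-combine n i j = cong proj₁ (remQuot-combine i j)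

nbrSum+partSum≡∑ : ∀ n p (f : Vector ℕ (p * n)) u →
  nbrSum (H n p) f u + partSum n p f (quotient {p} n u) ≡ sum f
nbrSum+partSum≡∑ n p f u = begin
  nbrSum (H n p) f u + partSum n p f a
    ≡⟨ cong (_+ partSum n p f a) (foldr-map-allFin _+_ 0 (p * n) g) ⟩
  sum g + partSum n p f a
    ≡⟨ cong (_+ partSum n p f a) (∑-combine p n g) ⟩
  ∑[ i < p ] ∑[ j < n ] g (combine i j) + partSum n p f a
    ≡⟨ cong (_+ partSum n p f a) (sum-cong-≗ λ i →
         trans (sum-cong-≗ (g-combine i)) (∑-if (not ⌊ a ≟ i ⌋) (λ j → f (combine i j)))) ⟩
  ∑[ i < p ] (if not ⌊ a ≟ i ⌋ then partSum n p f i else 0) + partSum n p f a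
    ≡⟨ ∑-except (partSum n p f) a ⟩
  ∑[ i < p ] partSum n p f i
    ≡⟨ ∑-combine p n f ⟨
  sum f ∎
  where
  a = quotient {p} n u
  g : Vector ℕ (p * n)
  g v = if not ⌊ a ≟ quotient {p} n v ⌋ then f v else 0
  g-combine : ∀ i j → g (combine i j) ≡ (if not ⌊ a ≟ i ⌋ then f (combine i j) else 0)
  g-combine i j = cong (λ k → if not ⌊ a ≟ k ⌋ then f (combine i j) else 0) (quotient-combine n i j)

constant-partSum⇒magic : ∀ n p (f : Vector ℕ (p * n)) s →
  (∀ i → partSum n p f i ≡ s) → ∀ u → nbrSum (H n p) f u ≡ sum f ∸ s
constant-partSum⇒magic n p f s partSum≡s u = begin
  nbrSum (H n p) f u
    ≡⟨ m+n∸n≡m (nbrSum (H n p) f u) s ⟨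
  nbrSum (H n p) f u + s ∸ s
    ≡⟨ cong (λ t → nbrSum (H n p) f u + t ∸ s) (partSum≡s (quotient {p} n u)) ⟨
  nbrSum (H n p) f u + partSum n p f (quotient {p} n u) ∸ s
    ≡⟨ cong (_∸ s) (nbrSum+partSum≡∑ n p f u) ⟩
  sum f ∸ s ∎

magic⇒partSum≡ : ∀ n p (f : Vector ℕ (p * n)) c →
  (∀ u → nbrSum (H n p) f u ≡ c) → ∀ u → partSum n p f (quotient {p} n u) ≡ sum f ∸ c
magic⇒partSum≡ n p f c magic u = begin
  partSum n p f (quotient {p} n u)
    ≡⟨ m+n∸m≡n c (partSum n p f (quotient {p} n u)) ⟨
  c + partSum n p f (quotient {p} n u) ∸ c
    ≡⟨ cong (λ t → t + _ ∸ c) (magic u) ⟨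
  nbrSum (H n p) f u + partSum n p f (quotient {p} n u) ∸ c
    ≡⟨ cong (_∸ c) (nbrSum+partSum≡∑ n p f u) ⟩
  sum f ∸ c ∎

-- Lower bounds on the largest label

injective-positive⇒≤ : ∀ {N M} (f : Fin N → ℕ) → Injective _≡_ _≡_ f →
  (∀ v → 1 ≤ f v) → (∀ v → f v ≤ M) → N ≤ M
injective-positive⇒≤ {M = M} f f-injective pos f≤M = injective⇒≤ g-injective
  where
  pred< : ∀ {a} → 1 ≤ a → a ≤ M → pred a < M
  pred< (s≤s _) a≤M = a≤M
  g : Fin _ → Fin M
  g v = fromℕ< (pred< (pos v) (f≤M v))
  g-injective : Injective _≡_ _≡_ g
  g-injective {u} {v} gu≡gv = f-injective
    (pred-injective {{>-nonZero (pos u)}} {{>-nonZero (pos v)}} (fromℕ<-injective _ _ _ _ gu≡gv))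

order≤maxLabel : ∀ G f → IsMagicLabelling G f → order G ≤ maxLabel G f
order≤maxLabel G f (f-injective , pos , _) =
  subst (order G ≤_) (sym (maxLabel≡maximum G f)) (injective-positive⇒≤ f f-injective pos (≤-maximum f))

∑*2≡N*[1+N] : ∀ N (f : Fin N → ℕ) → Injective _≡_ _≡_ f →
  (∀ v → 1 ≤ f v) → (∀ v → f v ≤ N) → sum f * 2 ≡ N * suc N
∑*2≡N*[1+N] zero    f _ _ _ = refl
∑*2≡N*[1+N] (suc N) f f-injective pos f≤1+N with any? (λ v → f v ≟ℕ suc N)
... | no ∄v = ⊥-elim (1+n≰n (injective-positive⇒≤ f f-injective pos f≤N))
  where
  f≤N : ∀ v → f v ≤ N
  f≤N v = s≤s⁻¹ (≤∧≢⇒< (f≤1+N v) (λ fv≡ → ∄v (v , fv≡)))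
... | yes (u , fu≡1+N) = begin
  sum f * 2                    ≡⟨ cong (_* 2) (sum-remove {i = u} f) ⟩
  (f u + sum g) * 2            ≡⟨ cong (λ t → (t + sum g) * 2) fu≡1+N ⟩
  (suc N + sum g) * 2          ≡⟨ *-distribʳ-+ 2 (suc N) (sum g) ⟩
  suc N * 2 + sum g * 2        ≡⟨ cong (suc N * 2 +_) (∑*2≡N*[1+N] N g g-injective (pos ∘ punchIn u) g≤N) ⟩
  suc N * 2 + N * suc N        ≡⟨ triangle-step N ⟩
  suc N * suc (suc N)          ∎
  where
  g = f ∘ punchIn u
  g-injective : Injective _≡_ _≡_ g
  g-injective {v} {w} gv≡gw = punchIn-injective u v w (f-injective gv≡gw)
  g≤N : ∀ v → g v ≤ N
  g≤N v = s≤s⁻¹ (≤∧≢⇒< (f≤1+N (punchIn u v))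
    (λ gv≡1+N → punchInᵢ≢i u v (f-injective (trans gv≡1+N (sym fu≡1+N)))))
  triangle-step : ∀ N → suc N * 2 + N * suc N ≡ suc N * suc (suc N)
  triangle-step = solve-∀

¬2∣n*[1+p*n] : ∀ {n p} → ¬ 2 ∣ n → 2 ∣ p → ¬ 2 ∣ n * suc (p * n)
¬2∣n*[1+p*n] {n} {p} 2∤n 2∣p 2∣n*[1+p*n]
  with euclidsLemma n (suc (p * n)) prime[2] 2∣n*[1+p*n]
... | inj₁ 2∣n      = 2∤n 2∣n
... | inj₂ 2∣1+p*n
  with () ← ∣1⇒≡1 (∣m+n∣m⇒∣n (subst (2 ∣_) (+-comm 1 (p * n)) 2∣1+p*n) (∣-trans 2∣p (m∣m*n n)))

magic-labels≰order : ∀ n p .{{_ : NonZero p}} → ¬ 2 ∣ n → 2 ∣ p →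
  ∀ f → IsMagicLabelling (H n p) f → ¬ (∀ v → f v ≤ p * n)
magic-labels≰order zero    p 2∤n _ _ _ _ = 2∤n (2 ∣0)
magic-labels≰order n@(suc _) p 2∤n 2∣p f (f-injective , pos , c , magic) f≤pn =
  ¬2∣n*[1+p*n] 2∤n 2∣p (divides S (sym (*-cancelˡ-≡ (S * 2) _ p p*S*2≡p*n*[1+p*n])))
  where
  S = sum f ∸ c
  partSum≡S : ∀ i → partSum n p f i ≡ S
  partSum≡S i = subst (λ k → partSum n p f k ≡ S) (quotient-combine n i zero)
    (magic⇒partSum≡ n p f c magic (combine i zero))
  p*S*2≡p*n*[1+p*n] : p * (S * 2) ≡ p * (n * suc (p * n))
  p*S*2≡p*n*[1+p*n] = begin
    p * (S * 2)               ≡⟨ *-assoc p S 2 ⟨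
    p * S * 2                 ≡⟨ cong (_* 2) (∑-const p S) ⟨
    (∑[ i < p ] S) * 2        ≡⟨ cong (_* 2) (sum-cong-≗ partSum≡S) ⟨
    (∑[ i < p ] partSum n p f i) * 2 ≡⟨ cong (_* 2) (∑-combine p n f) ⟨
    sum f * 2                 ≡⟨ ∑*2≡N*[1+N] (p * n) f f-injective pos f≤pn ⟩
    p * n * suc (p * n)       ≡⟨ *-assoc p n _ ⟩
    p * (n * suc (p * n))     ∎

ThetaIs-intro : ∀ G t f → IsMagicLabelling G f → maxLabel G f ≤ order G + t →
  (∀ g → IsMagicLabelling G g → order G + t ≤ maxLabel G g) → ThetaIs G t
ThetaIs-intro G t f f-magic f≤ ≤g = (f , f-magic , ≤-antisym f≤ (≤g f f-magic)) , ≤g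

-- Arrays with distinct entries and equal row sums

splitAt-injective : ∀ m {n} {i j : Fin (m + n)} → splitAt m i ≡ splitAt m j → i ≡ j
splitAt-injective m {n} {i} {j} eq =
  trans (sym (join-splitAt m n i)) (trans (cong (join m n) eq) (join-splitAt m n j))

++-injective : ∀ {A : Set} {m n} {xs : Vector A m} {ys : Vector A n} →
  Injective _≡_ _≡_ xs → Injective _≡_ _≡_ ys → (∀ i j → xs i ≢ ys j) → Injective _≡_ _≡_ (xs ++ ys)
++-injective {m = m} xs-injective ys-injective disjoint {i} {j} eq
  with splitAt m i in i≡ | splitAt m j in j≡
... | inj₁ x | inj₁ x' = splitAt-injective m (trans i≡ (trans (cong inj₁ (xs-injective eq)) (sym j≡)))
... | inj₁ x | inj₂ y' = ⊥-elim (disjoint x y' eq)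
... | inj₂ y | inj₁ x' = ⊥-elim (disjoint x' y (sym eq))
... | inj₂ y | inj₂ y' = splitAt-injective m (trans i≡ (trans (cong inj₂ (ys-injective eq)) (sym j≡)))

-- Row i holds the labels of part i, lowered by one so that entries start at 0.
Array : ℕ → ℕ → Set
Array p n = Fin p → Vector ℕ n

Distinct : ∀ {p n} → Array p n → Set
Distinct A = ∀ i j i' j' → A i j ≡ A i' j' → i ≡ i' × j ≡ j'

Bounded : ∀ {p n} → Array p n → ℕ → Set
Bounded A M = ∀ i j → A i j < M

RowMagic : ∀ {p n} → Array p n → Set
RowMagic A = ∃ λ s → ∀ i → sum (A i) ≡ s

column : ∀ {p} → Vector ℕ p → Array p 1
column x i _ = x i

column-distinct : ∀ {p} {x : Vector ℕ p} → Injective _≡_ _≡_ x → Distinct (column x)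
column-distinct x-injective i zero i' zero eq = x-injective eq , refl

beside : ∀ {p m k} → ℕ → Array p m → Array p k → Array p (m + k)
beside s A B i = A i ++ λ j → s + B i j

module _ {p m k s : ℕ} {A : Array p m} {B : Array p k} where

  beside-bounded : ∀ {t} → Bounded A s → Bounded B t → Bounded (beside s A B) (s + t)
  beside-bounded {t} A<s B<t i j with splitAt m j
  ... | inj₁ x = ≤-trans (A<s i x) (m≤m+n s t)
  ... | inj₂ y = +-monoʳ-< s (B<t i y)

  beside-distinct : Bounded A s → Distinct A → Distinct B → Distinct (beside s A B)
  beside-distinct A<s A-distinct B-distinct i j i' j' eq
    with splitAt m j in j≡ | splitAt m j' in j'≡
  ... | inj₁ x | inj₁ x' with A-distinct i x i' x' eq
  ...   | i≡i' , x≡x' = i≡i' , splitAt-injective m (trans j≡ (trans (cong inj₁ x≡x') (sym j'≡)))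
  beside-distinct A<s _ _ i j i' j' eq | inj₁ x | inj₂ y' =
    ⊥-elim (<⇒≢ (≤-trans (A<s i x) (m≤m+n s _)) eq)
  beside-distinct A<s _ _ i j i' j' eq | inj₂ y | inj₁ x' =
    ⊥-elim (<⇒≢ (≤-trans (A<s i' x') (m≤m+n s _)) (sym eq))
  beside-distinct _ _ B-distinct i j i' j' eq | inj₂ y | inj₂ y'
    with B-distinct i y i' y' (+-cancelˡ-≡ s _ _ eq)
  ...   | i≡i' , y≡y' = i≡i' , splitAt-injective m (trans j≡ (trans (cong inj₂ y≡y') (sym j'≡)))

  ∑-beside : ∀ i → sum (beside s A B i) ≡ sum (A i) + (k * s + sum (B i))
  ∑-beside i = trans (∑-++ (A i) _) (cong (sum (A i) +_) (∑-shift s (B i)))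

  beside-rowMagic : RowMagic A → RowMagic B → RowMagic (beside s A B)
  beside-rowMagic (a , ∑A≡a) (b , ∑B≡b) =
    a + (k * s + b) , λ i → trans (∑-beside i) (cong₂ (λ u v → u + (k * s + v)) (∑A≡a i) (∑B≡b i))

record MagicArray (p n M : ℕ) : Set where
  field
    entry    : Array p n
    distinct : Distinct entry
    bounded  : Bounded entry M
    rowMagic : RowMagic entry
open MagicArray

_∥_ : ∀ {p m k s t} → MagicArray p m s → MagicArray p k t → MagicArray p (m + k) (s + t)
_∥_ {s = s} A B = record
  { entry    = beside s (entry A) (entry B)
  ; distinct = beside-distinct (bounded A) (distinct A) (distinct B)
  ; bounded  = beside-bounded (bounded A) (bounded B)
  ; rowMagic = beside-rowMagic {A = entry A} {B = entry B} (rowMagic A) (rowMagic B)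
  }

emptyArray : ∀ {p} → MagicArray p 0 0
emptyArray = record
  { entry    = λ _ ()
  ; distinct = λ _ ()
  ; bounded  = λ _ ()
  ; rowMagic = 0 , λ _ → refl
  }

magicLabelling : ∀ {n p M} → MagicArray p n M →
  ∃ λ f → IsMagicLabelling (H n p) f × maxLabel (H n p) f ≤ M
magicLabelling {n} {p} {M} A =
  f , (f-injective , (λ _ → s≤s z≤n) , (sum f ∸ (n * 1 + s) , magic)) , f≤M
  where
  s = proj₁ (rowMagic A)
  f : Fin (p * n) → ℕ
  f u = suc (entry A (quotient {p} n u) (remainder {p} n u))
  f-injective : Injective _≡_ _≡_ f
  f-injective {u} {v} fu≡fv with distinct A _ _ _ _ (suc-injective fu≡fv)
  ... | q≡ , r≡ =
    trans (sym (combine-remQuot {p} n u)) (trans (cong₂ combine q≡ r≡) (combine-remQuot {p} n v))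
  partSum≡ : ∀ i → partSum n p f i ≡ n * 1 + s
  partSum≡ i = begin
    partSum n p f i
      ≡⟨ sum-cong-≗ (λ j → cong (λ (k , l) → suc (entry A k l)) (remQuot-combine i j)) ⟩
    ∑[ j < n ] (1 + entry A i j)
      ≡⟨ ∑-shift 1 (entry A i) ⟩
    n * 1 + sum (entry A i)
      ≡⟨ cong (n * 1 +_) (proj₂ (rowMagic A) i) ⟩
    n * 1 + s ∎
  magic = constant-partSum⇒magic n p f (n * 1 + s) partSum≡
  f≤M : maxLabel (H n p) f ≤ M
  f≤M = subst (_≤ M) (sym (maxLabel≡maximum (H n p) f))
    (maximum-≤ (λ u → bounded A (quotient {p} n u) (remainder {p} n u)))

ThetaIs-from-array : ∀ {n p M} t → MagicArray p n M → M ≤ p * n + t →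
  (∀ g → IsMagicLabelling (H n p) g → p * n + t ≤ maxLabel (H n p) g) → ThetaIs (H n p) t
ThetaIs-from-array {n} {p} t A M≤ lower with magicLabelling A
... | f , f-magic , f≤M = ThetaIs-intro (H n p) t f f-magic (≤-trans f≤M M≤) lower

ThetaIs-zero-from-array : ∀ {n p M} → MagicArray p n M → M ≤ p * n → ThetaIs (H n p) 0
ThetaIs-zero-from-array {n} {p} {M} A M≤ =
  ThetaIs-from-array 0 A (subst (M ≤_) (sym (+-identityʳ (p * n))) M≤)
    (λ g g-magic → subst (_≤ maxLabel (H n p) g) (sym (+-identityʳ (p * n)))
                     (order≤maxLabel (H n p) g g-magic))

ThetaIs-one-from-array : ∀ {n p M} .{{_ : NonZero p}} → ¬ 2 ∣ n → 2 ∣ p →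
  MagicArray p n M → M ≤ p * n + 1 → ThetaIs (H n p) 1
ThetaIs-one-from-array {n} {p} 2∤n 2∣p A M≤ = ThetaIs-from-array 1 A M≤ order<maxLabel
  where
  order<maxLabel : ∀ g → IsMagicLabelling (H n p) g → p * n + 1 ≤ maxLabel (H n p) g
  order<maxLabel g g-magic = subst (_≤ maxLabel (H n p) g) (+-comm 1 (p * n)) (≰⇒> λ max≤pn →
    magic-labels≰order n p 2∤n 2∣p g g-magic λ v →
      ≤-trans (≤-maximum g v) (subst (_≤ p * n) (maxLabel≡maximum (H n p) g) max≤pn))

-- The constructions

opposite-injective : ∀ {n} → Injective _≡_ _≡_ (opposite {n})
opposite-injective {x = i} {j} eq =
  trans (sym (opposite-involutive i)) (trans (cong opposite eq) (opposite-involutive j))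

toℕ+toℕ-opposite : ∀ {n} (i : Fin n) → suc (toℕ i + toℕ (opposite i)) ≡ n
toℕ+toℕ-opposite i = trans (cong (suc (toℕ i) +_) (opposite-prop i)) (m+[n∸m]≡n (toℕ<n i))

pairBlock : ∀ p → MagicArray p 2 (p + p)
pairBlock p = record
  { entry    = beside p (column toℕ) (column (toℕ ∘ opposite))
  ; distinct = beside-distinct toℕ<p (column-distinct toℕ-injective)
                 (column-distinct (opposite-injective ∘ toℕ-injective))
  ; bounded  = beside-bounded toℕ<p (λ i _ → toℕ<n (opposite i))
  ; rowMagic = pred (p + p) , rowSum
  }
  where
  toℕ<p : Bounded (column toℕ) p
  toℕ<p i _ = toℕ<n i
  regroup : ∀ x y s → x + 0 + (1 * s + (y + 0)) ≡ x + y + s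
  regroup = solve-∀
  rowSum : ∀ i → sum (beside p (column toℕ) (column (toℕ ∘ opposite)) i) ≡ pred (p + p)
  rowSum i = begin
    sum (beside p (column toℕ) (column (toℕ ∘ opposite)) i)
      ≡⟨ ∑-beside {A = column toℕ} {B = column (toℕ ∘ opposite)} i ⟩
    toℕ i + 0 + (1 * p + (toℕ (opposite i) + 0))
      ≡⟨ regroup (toℕ i) (toℕ (opposite i)) p ⟩
    pred (suc (toℕ i + toℕ (opposite i)) + p)
      ≡⟨ cong (λ t → pred (t + p)) (toℕ+toℕ-opposite i) ⟩
    pred (p + p) ∎

pairBlocks : ∀ p q → MagicArray p (q * 2) (q * (p + p))
pairBlocks p zero    = emptyArray
pairBlocks p (suc q) = pairBlock p ∥ pairBlocks p q

evenArray : ∀ p q → MagicArray p (q * 2) (p * (q * 2))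
evenArray p q = subst (MagicArray p (q * 2)) (bound q p) (pairBlocks p q)
  where
  bound : ∀ q p → q * (p + p) ≡ p * (q * 2)
  bound = solve-∀

2*m<n+o : ∀ {m n o} → m < n → m ≤ o → 2 * m < n + o
2*m<n+o {m} m<n m≤o = +-mono-<-≤ m<n (subst (_≤ _) (sym (+-identityʳ m)) m≤o)

1+2*m<n+o : ∀ {m n o} → m < o → o ≤ n → suc (2 * m) < n + o
1+2*m<n+o {m} m<o o≤n = +-mono-≤-< (≤-trans m<o o≤n) (subst (_< _) (sym (+-identityʳ m)) m<o)

-- δ = 0 serves odd p and δ = 1 even p; in the latter case column B skips the value b,
-- which is why the labels then run up to pn + 1.
module TripleBlock (m δ : ℕ) (δ≤1 : δ ≤ 1) where

  a b P : ℕ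
  a = suc m
  b = δ + m
  P = a + b

  colA colB colC : Vector ℕ P
  colA = toℕ {a} ++ λ (y : Fin b) → a + toℕ y
  colB = (λ (x : Fin a) → δ + (toℕ x + b)) ++ toℕ {b}
  colC = (λ (x : Fin a) → 2 * toℕ (opposite x)) ++ (λ (y : Fin b) → suc (2 * toℕ (opposite y)))

  colA-injective : Injective _≡_ _≡_ colA
  colA-injective = ++-injective toℕ-injective (λ eq → toℕ-injective (+-cancelˡ-≡ a _ _ eq))
    (λ x y → <⇒≢ (≤-trans (toℕ<n x) (m≤m+n a (toℕ y))))

  colB-injective : Injective _≡_ _≡_ colB
  colB-injective =
    ++-injective (λ eq → toℕ-injective (+-cancelʳ-≡ b _ _ (+-cancelˡ-≡ δ _ _ eq))) toℕ-injective
      (λ x y eq → <⇒≢ (≤-trans (toℕ<n y) (≤-trans (m≤n+m b (toℕ x)) (m≤n+m _ δ))) (sym eq))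

  colC-injective : Injective _≡_ _≡_ colC
  colC-injective = ++-injective {m = a} (λ eq → halve eq) (λ eq → halve (suc-injective eq))
    (λ x y → even≢odd (toℕ (opposite x)) (toℕ (opposite y)))
    where
    halve : ∀ {k} {x y : Fin k} → 2 * toℕ (opposite x) ≡ 2 * toℕ (opposite y) → x ≡ y
    halve eq = opposite-injective (toℕ-injective (*-cancelˡ-≡ _ _ 2 eq))

  colSum : ∀ i → colA i + colB i + colC i ≡ 2 * δ + 3 * m
  colSum i with splitAt a i
  ... | inj₁ x = begin
    toℕ x + (δ + (toℕ x + b)) + 2 * toℕ (opposite x)
      ≡⟨ left-regroup (toℕ x) (toℕ (opposite x)) δ m ⟩
    2 * δ + m + 2 * (toℕ x + toℕ (opposite x))
      ≡⟨ cong (λ t → 2 * δ + m + 2 * t) (suc-injective (toℕ+toℕ-opposite x)) ⟩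
    2 * δ + m + 2 * m
      ≡⟨ collect δ m ⟩
    2 * δ + 3 * m ∎
    where
    left-regroup : ∀ x o δ m → x + (δ + (x + (δ + m))) + 2 * o ≡ 2 * δ + m + 2 * (x + o)
    left-regroup = solve-∀
    collect : ∀ δ m → 2 * δ + m + 2 * m ≡ 2 * δ + 3 * m
    collect = solve-∀
  ... | inj₂ y = begin
    a + toℕ y + toℕ y + suc (2 * toℕ (opposite y))
      ≡⟨ right-regroup (toℕ y) (toℕ (opposite y)) m ⟩
    m + 2 * suc (toℕ y + toℕ (opposite y))
      ≡⟨ cong (λ t → m + 2 * t) (toℕ+toℕ-opposite y) ⟩
    m + 2 * (δ + m)
      ≡⟨ collect δ m ⟩
    2 * δ + 3 * m ∎
    where
    right-regroup : ∀ y o m → suc m + y + y + suc (2 * o) ≡ m + 2 * suc (y + o)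
    right-regroup = solve-∀
    collect : ∀ δ m → m + 2 * (δ + m) ≡ 2 * δ + 3 * m
    collect = solve-∀

  colA<P : ∀ i → colA i < P
  colA<P i with splitAt a i
  ... | inj₁ x = ≤-trans (toℕ<n x) (m≤m+n a b)
  ... | inj₂ y = +-monoʳ-< a (toℕ<n y)

  colB<δ+P : ∀ i → colB i < δ + P
  colB<δ+P i with splitAt a i
  ... | inj₁ x = +-monoʳ-< δ (+-monoˡ-< b (toℕ<n x))
  ... | inj₂ y = ≤-trans (toℕ<n y) (≤-trans (m≤n+m b a) (m≤n+m _ δ))

  colC<P : ∀ i → colC i < P
  colC<P i with splitAt a i
  ... | inj₁ x = 2*m<n+o (toℕ<n (opposite x)) (≤-trans (s≤s⁻¹ (toℕ<n (opposite x))) (m≤n+m m δ))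
  ... | inj₂ y = 1+2*m<n+o (toℕ<n (opposite y)) (+-monoˡ-≤ m δ≤1)

  tripleBlock : MagicArray P 3 (P + (δ + P + P))
  tripleBlock = record
    { entry    = rows
    ; distinct = beside-distinct {A = column colA} (λ i _ → colA<P i) (column-distinct colA-injective) rest-distinct
    ; bounded  = beside-bounded {A = column colA} (λ i _ → colA<P i) rest-bounded
    ; rowMagic = 2 * P + (δ + P) + (2 * δ + 3 * m) , rowSum
    }
    where
    rest : Array P 2
    rest = beside (δ + P) (column colB) (column colC)
    rest-distinct : Distinct rest
    rest-distinct = beside-distinct {A = column colB} {B = column colC} (λ i _ → colB<δ+P i)
      (column-distinct colB-injective) (column-distinct colC-injective)
    rest-bounded : Bounded rest (δ + P + P)
    rest-bounded = beside-bounded {A = column colB} {B = column colC} (λ i _ → colB<δ+P i) (λ i _ → colC<P i)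
    rows : Array P 3
    rows = beside P (column colA) rest
    regroup : ∀ x y z s t → x + 0 + (2 * s + (y + 0 + (1 * t + (z + 0)))) ≡ 2 * s + t + (x + y + z)
    regroup = solve-∀
    rowSum : ∀ i → sum (rows i) ≡ 2 * P + (δ + P) + (2 * δ + 3 * m)
    rowSum i = begin
      sum (rows i)
        ≡⟨ ∑-beside {s = P} {A = column colA} {B = rest} i ⟩
      colA i + 0 + (2 * P + sum (rest i))
        ≡⟨ cong (λ t → colA i + 0 + (2 * P + t)) (∑-beside {s = δ + P} {A = column colB} {B = column colC} i) ⟩
      colA i + 0 + (2 * P + (colB i + 0 + (1 * (δ + P) + (colC i + 0))))
        ≡⟨ regroup (colA i) (colB i) (colC i) P (δ + P) ⟩
      2 * P + (δ + P) + (colA i + colB i + colC i)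
        ≡⟨ cong (2 * P + (δ + P) +_) (colSum i) ⟩
      2 * P + (δ + P) + (2 * δ + 3 * m)
        ∎

  oddArray : ∀ q → MagicArray P (3 + q * 2) (P * (3 + q * 2) + δ)
  oddArray q = subst (MagicArray P (3 + q * 2)) (bound P δ q) (tripleBlock ∥ pairBlocks P q)
    where
    bound : ∀ P δ q → P + (δ + P + P) + q * (P + P) ≡ P * (3 + q * 2) + δ
    bound = solve-∀

odd⇒≡1+[n/2]*2 : ∀ n → ¬ 2 ∣ n → n ≡ suc (n / 2 * 2)
odd⇒≡1+[n/2]*2 n 2∤n with n % 2 in n%2≡ | m%n<n n 2
... | 0           | _ = ⊥-elim (2∤n (m%n≡0⇒n∣m n 2 n%2≡))
... | 1           | _ = trans (m≡m%n+[m/n]*n n 2) (cong (_+ n / 2 * 2) n%2≡)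
... | suc (suc _) | s≤s (s≤s ())

n*2≡n+n : ∀ n → n * 2 ≡ n + n
n*2≡n+n = solve-∀

odd>1⇒≡3+q*2 : ∀ {n} → 1 < n → ¬ 2 ∣ n → ∃ λ q → n ≡ 3 + q * 2
odd>1⇒≡3+q*2 {n} 1<n 2∤n with n / 2 | odd⇒≡1+[n/2]*2 n 2∤n
... | zero  | refl = ⊥-elim (<-irrefl refl 1<n)
... | suc q | n≡  = q , n≡

odd⇒≡1+k+k : ∀ {p} → ¬ 2 ∣ p → ∃ λ k → p ≡ suc k + k
odd⇒≡1+k+k {p} 2∤p = p / 2 , trans (odd⇒≡1+[n/2]*2 p 2∤p) (cong suc (n*2≡n+n (p / 2)))

even>0⇒≡1+k+1+k : ∀ {p} → 0 < p → 2 ∣ p → ∃ λ k → p ≡ suc k + suc k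
even>0⇒≡1+k+1+k 0<p (divides zero refl)    = ⊥-elim (<-irrefl refl 0<p)
even>0⇒≡1+k+1+k _   (divides (suc k) p≡) = k , trans p≡ (n*2≡n+n (suc k))

theorem11 : (n p : ℕ) → 1 < n → 1 < p →
    ((2 ∣ n ⊎ (¬ (2 ∣ n) × ¬ (2 ∣ p))) → ThetaIs (H n p) 0)
    × ((¬ (2 ∣ n) × 2 ∣ p) → ThetaIs (H n p) 1)
theorem11 n p 1<n 1<p = θ≡0 , θ≡1
  where
  θ≡0 : 2 ∣ n ⊎ (¬ 2 ∣ n × ¬ 2 ∣ p) → ThetaIs (H n p) 0
  θ≡0 (inj₁ (divides q refl)) = ThetaIs-zero-from-array (evenArray p q) ≤-refl
  θ≡0 (inj₂ (2∤n , 2∤p)) with odd>1⇒≡3+q*2 1<n 2∤n | odd⇒≡1+k+k 2∤p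
  ... | q , refl | k , refl =
    ThetaIs-zero-from-array (TripleBlock.oddArray k 0 z≤n q) (≤-reflexive (+-identityʳ _))
  θ≡1 : ¬ 2 ∣ n × 2 ∣ p → ThetaIs (H n p) 1
  θ≡1 (2∤n , 2∣p) with odd>1⇒≡3+q*2 1<n 2∤n | even>0⇒≡1+k+1+k (<-trans z<s 1<p) 2∣p
  ... | q , refl | k , refl = ThetaIs-one-from-array 2∤n 2∣p (TripleBlock.oddArray k 1 ≤-refl q) ≤-refl
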